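{- Let $\Pi^\perp_\tau$ be the projection representation of a comtrace $\tau$ over a comtrace alphabet $\Theta$, and let $M(\Pi^\perp_\tau)$ be its set of possible actions. For every allowed set $B\in\mathbb{S}$ (constructed from $M(\Pi^\perp_\tau)$ as described below), we have \[\tau=[B]\circ\sigma,\quad\text{where }\sigma\text{ is the comtrace with }\Pi^\perp_\sigma=extr(\Pi^\perp_\tau,B).\]
   Context: A comtrace alphabet is $\Theta=(\Sigma,\mathit{sim},\mathit{ser})$ with $\mathit{ser}\subseteq\mathit{sim}\subseteq\Sigma\times\Sigma$, $\mathit{sim}$ irreflexive and symmetric. Steps $\mathbb{S}$ are nonempty sets of pairwise $\mathit{sim}$-related actions; comtrace equivalence $\equiv_\Theta$ is the reflexive, symmetric, transitive closure of $uABz\sim u(A\cup B)z$ for $A\times B\subseteq\mathit{ser}$; comtraces are its classes, concatenated by $[w]\circ[v]=[wv]$. Derived relations: $\mathit{dep}=(\Sigma\times\Sigma)\setminus\mathit{sim}$, $\mathit{ind}=\mathit{ser}\cap\mathit{ser}^{ -1}$, $\mathit{sin}=\mathit{sim}\setminus\mathit{ser}$, $\mathit{ssm}=\mathit{sim}\setminus(\mathit{ser}\cup\mathit{ser}^{ -1})$, $\mathit{wdp}=\mathit{ser}^{ -1}\setminus\mathit{ser}$. For $(a,b)\notin\mathit{ind}$, the projection $\Pi^\perp_{a,b}$ maps a step $A$ to: $\epsilon$ if $\{a,b\}\cap A=\emptyset$; the single action of $\{a,b\}$ in $A$ if exactly one is in $A$; $ba$ if $\{a,b\}\subseteq A$,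 $(a,b)\in\mathit{wdp}$; $ab$ if $\{a,b\}\subseteq A$, $(b,a)\in\mathit{wdp}$; $\perp$ if $\{a,b\}\subseteq A$, $(a,b)\in\mathit{ssm}$; extended to step sequences by concatenation. The projection representation of $\tau$ is $\Pi^\perp_\tau(a,b)=\Pi^\perp_{a,b}(\tau)$ on $(\Sigma\times\Sigma)\setminus\mathit{ind}$; two step sequences are equivalent iff their projection representations agree. For a word $x$, write $x[1]$ for its first letter, $x[1..2]$ for its first two letters, and $x[k..]$ for the suffix of $x$ starting at its $k$-th letter (i.e. $x$ with its first $k-1$ letters removed). An action $a$ is conditionally possible for $\Pi^\perp$ iff for all $b$: $(a,b)\in\mathit{dep}\Rightarrow\Pi^\perp(a,b)[1]=a$; $(b,a)\in\mathit{wdp}\Rightarrow\Pi^\perp(a,b)[1]=a$; $(a,b)\in\mathit{wdp}\Rightarrow\Pi^\perp(a,b)[1]=a$ or $\Pi^\perp(a,b)[1..2]=ba$; $(a,b)\in\mathit{ssm}\Rightarrow\Pi^\perp(a,b)[1]\in\{a,\perp\}$. With $cpa$ the conditionally possible actions, $(a,b)\in cnd$ iff ($(a,b)\in\mathit{wdp}$ and $\Pi^\perp(a,b)[1..2]=ba$) or ($(a,b)\in\mathit{ssm}$ and $\Pi^\perp(a,b)[1]=\perp$); $imp$ is the smallest set containing $\Sigma\setminus cpa$ and closed under ($b\in imp,(a,b)\in cnd\Rightarrow a\in imp$); $M(\Pi^\perp)=\Sigma\setminus imp$. A step $A$ is indivisible if all its elements are related by the largest equivalence contained in the reflexive-transitive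 closure of $\mathit{sin}$ restricted to $A$. Splitting $M(\Pi^\perp)$ into its indivisible steps gives a step sequence of indivisible steps (the lexicographically least step sequence equivalent to the single step $M(\Pi^\perp)$), viewed as a Mazurkiewicz trace over the alphabet of indivisible steps where two indivisible steps $C,D$ are independent iff $C\times D\subseteq\mathit{ind}$. An allowed set $B$ is the union of the indivisible steps of any nonempty trace prefix of this trace. The extraction $extr(\Pi^\perp,B)(a,b)$ equals: $\Pi^\perp(a,b)$ if $|\{a,b\}\cap B|=0$; $\Pi^\perp(a,b)[2..]$ if $|\{a,b\}\cap B|=1$; $\Pi^\perp(a,b)[2..]$ if $|\{a,b\}\cap B|=2$ and $(a,b)\in\mathit{ssm}$; $\Pi^\perp(a,b)[3..]$ if $|\{a,b\}\cap B|=2$ and $(a,b)\in\mathit{wdp}\cup\mathit{wdp}^{ -1}$. -}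

module Defs where

open import Data.Nat using (ℕ)
open import Data.Fin using (Fin; _≟_)
open import Data.Bool using (Bool; true; false; T; not; _∧_; if_then_else_)
open import Data.Maybe using (Maybe; just)
open import Data.List using (List; []; _∷_; _++_; head; take; drop; concatMap)
open import Data.List.Relation.Unary.All using (All)
open import Data.Product using (Σ; _×_; _,_; ∃)
open import Data.Sum using (_⊎_)
open import Data.Fin.Subset using (Subset; _∈_; _∪_; ⋃; Nonempty)
open import Data.Fin.Subset.Properties using (_∈?_)
open import Relation.Nullary using (¬_; yes; no)
open import Relation.Binary.PropositionalEquality using (_≡_; _≢_)
open import Relation.Binary.Construct.Closure.Equivalence using (EqClosure)
open import Relation.Binary.Construct.Closure.ReflexiveTransitive using (Star)
open import Function.Bundles using (_⇔_)

record Alphabet : Set where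
  field
    n          : ℕ
    sim        : Fin n → Fin n → Bool
    ser        : Fin n → Fin n → Bool
    ser⊆sim    : ∀ a b → T (ser a b) → T (sim a b)
    sim-irrefl : ∀ a → ¬ T (sim a a)
    sim-sym    : ∀ a b → T (sim a b) → T (sim b a)

data Sym (n : ℕ) : Set where
  act : Fin n → Sym n
  bot : Sym n

module Comtrace (Θ : Alphabet) where
  open Alphabet Θ public

  Act : Set
  Act = Fin n

  Step : Set
  Step = Subset n

  dep ind sin ssm wdp : Act → Act → Bool
  dep a b = not (sim a b)
  ind a b = ser a b ∧ ser b a
  sin a b = sim a b ∧ not (ser a b)
  ssm a b = sim a b ∧ (not (ser a b) ∧ not (ser b a))
  wdp a b = ser b a ∧ not (ser a b)

  IsStep : Step → Set
  IsStep A = Nonempty A × (∀ a b → a ∈ A → b ∈ A → a ≢ b → T (sim a b))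

  SerProd : Step → Step → Set
  SerProd A B = ∀ a b → a ∈ A → b ∈ B → T (ser a b)

  data _∼_ : List Step → List Step → Set where
    merge : ∀ u A B z → IsStep A → IsStep B → SerProd A B →
            (u ++ A ∷ B ∷ z) ∼ (u ++ (A ∪ B) ∷ z)

  _≡Θ_ : List Step → List Step → Set
  _≡Θ_ = EqClosure _∼_

  Word : Set
  Word = List (Sym n)

  -- Π^⊥_{a,b} on a single step (only meaningful for (a,b) ∉ ind;
  -- the final fall-through case is unreachable for steps and non-ind pairs)
  projStep : Act → Act → Step → Word
  projStep a b A with a ≟ b | a ∈? A | b ∈? A
  ... | yes _ | yes _ | _     = act a ∷ []
  ... | yes _ | no _  | _     = []
  ... | no _  | no _  | no _  = []
  ... | no _  | yes _ | no _  = act a ∷ []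
  ... | no _  | no _  | yes _ = act b ∷ []
  ... | no _  | yes _ | yes _ =
    if wdp a b then act b ∷ act a ∷ []
    else if wdp b a then act a ∷ act b ∷ []
    else bot ∷ []

  proj : Act → Act → List Step → Word
  proj a b w = concatMap (projStep a b) w

  -- projection representations (relevant only on (Σ×Σ) ∖ ind)
  ProjRep : Set
  ProjRep = Act → Act → Word

  projRep : List Step → ProjRep
  projRep w a b = proj a b w

  cpa : ProjRep → Act → Set
  cpa Π a = ∀ b →
      (T (dep a b) → head (Π a b) ≡ just (act a))
    × (T (wdp b a) → head (Π a b) ≡ just (act a))
    × (T (wdp a b) → head (Π a b) ≡ just (act a)
                     ⊎ take 2 (Π a b) ≡ act b ∷ act a ∷ [])
    × (T (ssm a b) → head (Π a b) ≡ just (act a) ⊎ head (Π a b) ≡ just bot)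

  cnd : ProjRep → Act → Act → Set
  cnd Π a b = (T (wdp a b) × take 2 (Π a b) ≡ act b ∷ act a ∷ [])
            ⊎ (T (ssm a b) × head (Π a b) ≡ just bot)

  data Imp (Π : ProjRep) : Act → Set where
    base  : ∀ {a} → ¬ cpa Π a → Imp Π a
    close : ∀ {a b} → Imp Π b → cnd Π a b → Imp Π a

  InM : ProjRep → Act → Set
  InM Π a = ¬ Imp Π a

  SinOn : Step → Act → Act → Set
  SinOn A a c = a ∈ A × c ∈ A × T (sin a c)

  -- indivisible step: all elements related by the largest equivalence
  -- contained in (sin|A)*, i.e. (sin|A)* ∩ ((sin|A)*)⁻¹
  Indivisible : Step → Set
  Indivisible A = IsStep A ×
    (∀ a c → a ∈ A → c ∈ A → Star (SinOn A) a c × Star (SinOn A) c a)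

  IndProd : Step → Step → Set
  IndProd C D = ∀ c d → c ∈ C → d ∈ D → T (ind c d)

  data _⇄_ : List Step → List Step → Set where
    swap : ∀ u C D z → IndProd C D → (u ++ C ∷ D ∷ z) ⇄ (u ++ D ∷ C ∷ z)

  _≈tr_ : List Step → List Step → Set
  _≈tr_ = EqClosure _⇄_

  -- B is an allowed set for Π: Ms is the set M(Π), Cs is the splitting of
  -- M(Π) into indivisible steps (a sequence of indivisible steps comtrace
  -- equivalent to the single step M(Π)), and B is the union of the steps of a
  -- nonempty trace prefix p of the trace [Cs].
  Allowed : ProjRep → Step → Set
  Allowed Π B =
    Σ Step λ Ms → (∀ a → (a ∈ Ms ⇔ InM Π a)) ×
    Σ (List Step) λ Cs → All Indivisible Cs × (Cs ≡Θ (Ms ∷ [])) ×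
    Σ (List Step) λ p → Σ (List Step) λ q →
      p ≢ [] × ((p ++ q) ≈tr Cs) × B ≡ ⋃ p

  extr : ProjRep → Step → ProjRep
  extr Π B a b with a ≟ b | a ∈? B | b ∈? B
  ... | yes _ | yes _ | _     = drop 1 (Π a b)
  ... | yes _ | no _  | _     = Π a b
  ... | no _  | no _  | no _  = Π a b
  ... | no _  | yes _ | no _  = drop 1 (Π a b)
  ... | no _  | no _  | yes _ = drop 1 (Π a b)
  ... | no _  | yes _ | yes _ = if ssm a b then drop 1 (Π a b) else drop 2 (Π a b)

-- Every b ∈ B lies in M(Π), so b is conditionally possible: in each projection Π(b,c) either b
-- comes first or the first symbol makes b conditional on c, in which case c ∈ M(Π) as well.
-- Since M(Π) splits into ser-ordered indivisible steps, such a c lies in every trace prefix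
-- containing b, i.e. in B.  So in every projection nothing outside B precedes an element of B,
-- and this is exactly what is needed to pull B, step by step, to the front of τ.  The remainder
-- σ has Π_σ = extr(Π_τ, B) because comtrace equivalence preserves every Π_{a,b} with
-- (a,b) ∉ ind, and extr removes precisely the contribution of the step B.
module Submission where

open import Defs
open import Data.Bool using (Bool; true; false; T; not; if_then_else_)
open import Data.Bool.Properties using (T?; T-∧)
open import Data.Empty using (⊥-elim)
open import Data.Fin using (Fin; _≟_)
open import Data.Fin.Properties using (all?)
open import Data.Fin.Subset using (Subset; _∈_; _∉_; _⊆_; _∪_; _∩_; ∁; ⋃; Nonempty; Empty)
import Data.Fin.Subset as Subset
open import Data.Fin.Subset.Properties
  using ( _∈?_; nonempty?; ∉⊥; Empty-unique; x∈p∪q⁻; p⊆p∪q; q⊆p∪q; x∈p∩q⁺; x∈p∩q⁻; p∩q⊆p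
        ; x∉p⇒x∈∁p; x∈∁p⇒x∉p; ∪-assoc; ∪-comm; ∪-identityˡ; ∪-identityʳ; ∪-inverseʳ
        ; ∪-isCommutativeMonoid; ∩-comm; ∩-identityʳ; ∩-distribˡ-∪ )
open import Data.List using (List; []; _∷_; _++_; head; take; drop; concat; concatMap; map)
open import Data.List.Properties using (map-++; concat-++; ++-assoc; ++-identityʳ)
import Data.List.Properties as List
open import Data.List.Relation.Unary.All as All using (All; []; _∷_)
open import Data.List.Relation.Unary.All.Properties using (++⁺; ++⁻ˡ)
open import Data.List.Relation.Binary.Permutation.Propositional
  using (_↭_; ↭-refl; ↭-swap; ↭-sym; ↭-isEquivalence; ↭⇒↭ₛ)
open import Data.List.Relation.Binary.Permutation.Propositional.Properties using (All-resp-↭; ++⁺ˡ)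
import Data.List.Relation.Binary.Permutation.Setoid.Properties as PermutationSetoid
open import Data.Maybe using (just)
import Data.Maybe.Properties as Maybe
open import Data.Product using (Σ; _×_; _,_; proj₁; proj₂)
open import Data.Sum using (_⊎_; inj₁; inj₂; [_,_]′)
open import Data.Unit using (⊤; tt)
open import Function using (_∘_; id; case_of_)
open import Function.Bundles using (_⇔_; mk⇔; Equivalence)
open import Function.Properties.Equivalence using (⇔-isEquivalence)
open import Relation.Binary.Bundles using (Setoid)
import Relation.Binary.Construct.Closure.Equivalence as EqClosure
open import Relation.Binary.Definitions using (DecidableEquality)
open import Relation.Binary.PropositionalEquality
  using (_≡_; _≢_; refl; sym; trans; cong; subst; subst₂; module ≡-Reasoning)
  renaming (isEquivalence to ≡-isEquivalence; setoid to ≡-setoid)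
open import Relation.Nullary using (¬_; Dec; yes; no; contradiction)
open import Relation.Nullary.Decidable using (_×-dec_; _⊎-dec_; _→-dec_; decidable-stable)

open Equivalence using (to; from)

concatMap-++ : {A B : Set} (f : A → List B) (xs ys : List A) →
               concatMap f (xs ++ ys) ≡ concatMap f xs ++ concatMap f ys
concatMap-++ f xs ys = begin
  concat (map f (xs ++ ys))         ≡⟨ cong concat (map-++ f xs ys) ⟩
  concat (map f xs ++ map f ys)     ≡⟨ concat-++ (map f xs) (map f ys) ⟨
  concatMap f xs ++ concatMap f ys  ∎
  where open ≡-Reasoning

concatMap-cong-infix : {A B : Set} (f : A → List B) {xs ys : List A} →
                       concatMap f xs ≡ concatMap f ys →
                       ∀ u z → concatMap f (u ++ xs ++ z) ≡ concatMap f (u ++ ys ++ z)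
concatMap-cong-infix f {xs} {ys} eq [] z = begin
  concatMap f (xs ++ z)            ≡⟨ concatMap-++ f xs z ⟩
  concatMap f xs ++ concatMap f z  ≡⟨ cong (_++ concatMap f z) eq ⟩
  concatMap f ys ++ concatMap f z  ≡⟨ concatMap-++ f ys z ⟨
  concatMap f (ys ++ z)            ∎
  where open ≡-Reasoning
concatMap-cong-infix f eq (x ∷ u) z = cong (f x ++_) (concatMap-cong-infix f eq u z)

_≟ₛ_ : ∀ {n} → DecidableEquality (Sym n)
act x ≟ₛ act y with x ≟ y
... | yes refl = yes refl
... | no x≢y   = no λ { refl → x≢y refl }
act _ ≟ₛ bot   = no λ ()
bot   ≟ₛ act _ = no λ ()
bot   ≟ₛ bot   = yes refl

¬T⇒T-not : ∀ {x} → ¬ T x → T (not x)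
¬T⇒T-not {false} _  = tt
¬T⇒T-not {true}  ¬x = ¬x tt

∈-∉⇒≢ : ∀ {n} {x y : Fin n} {A : Subset n} → x ∈ A → y ∉ A → x ≢ y
∈-∉⇒≢ x∈ y∉ refl = y∉ x∈

∉-∈⇒≢ : ∀ {n} {x y : Fin n} {A : Subset n} → x ∉ A → y ∈ A → x ≢ y
∉-∈⇒≢ x∉ y∈ refl = x∉ y∈

∈-∪-∉ˡ : ∀ {n} {x : Fin n} {A B : Subset n} → x ∈ A ∪ B → x ∉ A → x ∈ B
∈-∪-∉ˡ {A = A} {B} x∈ x∉A = [ (λ x∈A → contradiction x∈A x∉A) , id ]′ (x∈p∪q⁻ A B x∈)

∉-∪ : ∀ {n} {x : Fin n} {A B : Subset n} → x ∉ A → x ∉ B → x ∉ A ∪ B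
∉-∪ {A = A} {B} x∉A x∉B x∈ = [ x∉A , x∉B ]′ (x∈p∪q⁻ A B x∈)

∈-∖ : ∀ {n} {x : Fin n} {A B : Subset n} → x ∈ A ∩ ∁ B → x ∈ A × x ∉ B
∈-∖ {A = A} {B} x∈ with x∈p∩q⁻ A (∁ B) x∈
... | x∈A , x∈∁B = x∈A , x∈∁p⇒x∉p x∈∁B

∩-∁-split : ∀ {n} (A B : Subset n) → (A ∩ B) ∪ (A ∩ ∁ B) ≡ A
∩-∁-split A B = begin
  (A ∩ B) ∪ (A ∩ ∁ B)  ≡⟨ ∩-distribˡ-∪ A B (∁ B) ⟨
  A ∩ (B ∪ ∁ B)        ≡⟨ cong (A ∩_) (∪-inverseʳ B) ⟩
  A ∩ Subset.⊤         ≡⟨ ∩-identityʳ A ⟩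
  A                    ∎
  where open ≡-Reasoning

⋃-++-merge : ∀ {n} (u : List (Subset n)) A B z → ⋃ (u ++ A ∷ B ∷ z) ≡ ⋃ (u ++ (A ∪ B) ∷ z)
⋃-++-merge []      A B z = sym (∪-assoc A B (⋃ z))
⋃-++-merge (D ∷ u) A B z = cong (D ∪_) (⋃-++-merge u A B z)

⋃-resp-↭ : ∀ {n} {x y : List (Subset n)} → x ↭ y → ⋃ x ≡ ⋃ y
⋃-resp-↭ = PermutationSetoid.foldr-commMonoid (≡-setoid (Subset _)) (∪-isCommutativeMonoid _) ∘ ↭⇒↭ₛ

⋃-++-⊆ : ∀ {n} (p q : List (Subset n)) → ⋃ p ⊆ ⋃ (p ++ q)
⋃-++-⊆ []      q x∈ = ⊥-elim (∉⊥ x∈)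
⋃-++-⊆ (D ∷ p) q x∈ = [ p⊆p∪q _ , (λ x∈p → q⊆p∪q D _ (⋃-++-⊆ p q x∈p)) ]′ (x∈p∪q⁻ D (⋃ p) x∈)

⋃-nonempty : ∀ {n} {p : List (Subset n)} → p ≢ [] → All Nonempty p → Nonempty (⋃ p)
⋃-nonempty {p = []}    p≢[] _                 = contradiction refl p≢[]
⋃-nonempty {p = D ∷ p} _    ((x , x∈D) ∷ _) = x , p⊆p∪q (⋃ p) x∈D

module Extraction (Θ : Alphabet) where
  open Comtrace Θ

  ser-irrefl : ∀ a → ¬ T (ser a a)
  ser-irrefl a = sim-irrefl a ∘ ser⊆sim a a

  ind-irrefl : ∀ a → ¬ T (ind a a)
  ind-irrefl a = ser-irrefl a ∘ proj₁ ∘ to T-∧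

  Clique : Step → Set
  Clique A = ∀ a b → a ∈ A → b ∈ A → a ≢ b → T (sim a b)

  Clique-⊆ : ∀ {A B} → A ⊆ B → Clique B → Clique A
  Clique-⊆ A⊆B cB a b a∈ b∈ = cB a b (A⊆B a∈) (A⊆B b∈)

  Clique-∪ : ∀ {A B} → Clique A → Clique B → SerProd A B → Clique (A ∪ B)
  Clique-∪ {A} {B} cA cB A→B a b a∈ b∈ a≢b with x∈p∪q⁻ A B a∈ | x∈p∪q⁻ A B b∈
  ... | inj₁ a∈A | inj₁ b∈A = cA a b a∈A b∈A a≢b
  ... | inj₁ a∈A | inj₂ b∈B = ser⊆sim a b (A→B a b a∈A b∈B)
  ... | inj₂ a∈B | inj₁ b∈A = sim-sym b a (ser⊆sim b a (A→B b a b∈A a∈B))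
  ... | inj₂ a∈B | inj₂ b∈B = cB a b a∈B b∈B a≢b

  SerProd-∪ˡ : ∀ {A B C} → SerProd (A ∪ B) C ⇔ (SerProd A C × SerProd B C)
  SerProd-∪ˡ {A} {B} = mk⇔
    (λ AB→C → (λ a c a∈ → AB→C a c (p⊆p∪q B a∈)) , (λ a c a∈ → AB→C a c (q⊆p∪q A B a∈)))
    (λ (A→C , B→C) a c a∈ → [ A→C a c , B→C a c ]′ (x∈p∪q⁻ A B a∈))

  SerProd-∪ʳ : ∀ {A B C} → SerProd A (B ∪ C) ⇔ (SerProd A B × SerProd A C)
  SerProd-∪ʳ {A} {B} {C} = mk⇔
    (λ A→BC → (λ a b a∈ b∈ → A→BC a b a∈ (p⊆p∪q C b∈)) , (λ a c a∈ c∈ → A→BC a c a∈ (q⊆p∪q B C c∈)))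
    (λ (A→B , A→C) a x a∈ x∈ → [ A→B a x a∈ , A→C a x a∈ ]′ (x∈p∪q⁻ B C x∈))

  open Setoid (EqClosure.setoid _∼_) using () renaming (reflexive to ≡⇒≡Θ)

  ∼-++ˡ : ∀ u {x y} → x ∼ y → (u ++ x) ∼ (u ++ y)
  ∼-++ˡ u (merge v A B z sA sB A→B) =
    subst₂ _∼_ (++-assoc u v _) (++-assoc u v _) (merge (u ++ v) A B z sA sB A→B)

  ≡Θ-++ˡ : ∀ u {x y} → x ≡Θ y → (u ++ x) ≡Θ (u ++ y)
  ≡Θ-++ˡ u = EqClosure.gmap (u ++_) (∼-++ˡ u)

  -- A possibly empty set as a step sequence; it spares case splits on which pieces are empty.
  ⟦_⟧ : Step → List Step
  ⟦ X ⟧ with nonempty? X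
  ... | yes _ = X ∷ []
  ... | no _  = []

  ⟦⟧-nonempty : ∀ {X} → Nonempty X → ⟦ X ⟧ ≡ X ∷ []
  ⟦⟧-nonempty {X} ne with nonempty? X
  ... | yes _  = refl
  ... | no ¬ne = contradiction ne ¬ne

  ⟦⟧-empty : ∀ {X} → Empty X → ⟦ X ⟧ ≡ []
  ⟦⟧-empty {X} ¬ne with nonempty? X
  ... | yes ne = contradiction ne ¬ne
  ... | no _   = refl

  ⟦⟧-isStep : ∀ {X} → Clique X → All IsStep ⟦ X ⟧
  ⟦⟧-isStep {X} cX with nonempty? X
  ... | yes ne = (ne , cX) ∷ []
  ... | no _   = []

  ⟦⟧-merge : ∀ {X Y} z → Clique X → Clique Y → SerProd X Y →
             (⟦ X ⟧ ++ ⟦ Y ⟧ ++ z) ≡Θ (⟦ X ∪ Y ⟧ ++ z)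
  ⟦⟧-merge {X} {Y} z cX cY X→Y with nonempty? X
  ... | no ¬neX = ≡⇒≡Θ (cong (λ S → ⟦ S ⟧ ++ z) (sym X∪Y≡Y))
    where
    X∪Y≡Y : X ∪ Y ≡ Y
    X∪Y≡Y = trans (cong (_∪ Y) (Empty-unique ¬neX)) (∪-identityˡ Y)
  ... | yes neX@(x , x∈X) with nonempty? Y
  ...   | no ¬neY = ≡⇒≡Θ (cong (_++ z) (sym X∪Y≡X))
    where
    X∪Y≡X : ⟦ X ∪ Y ⟧ ≡ X ∷ []
    X∪Y≡X = trans (cong ⟦_⟧ (trans (cong (X ∪_) (Empty-unique ¬neY)) (∪-identityʳ X))) (⟦⟧-nonempty neX)
  ...   | yes neY rewrite ⟦⟧-nonempty {X ∪ Y} (x , p⊆p∪q Y x∈X) =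
    EqClosure.return (merge [] X Y z (neX , cX) (neY , cY) X→Y)

  -- Sequences equivalent to a single step

  SerOrdered : List Step → Set
  SerOrdered []       = ⊤
  SerOrdered (D ∷ Ds) = SerProd D (⋃ Ds) × SerOrdered Ds

  ⋃-resp-∼ : ∀ {x y} → x ∼ y → ⋃ x ≡ ⋃ y
  ⋃-resp-∼ (merge u A B z _ _ _) = ⋃-++-merge u A B z

  SerOrdered-merge : ∀ (u : List Step) A B z → SerProd A B →
                     SerOrdered (u ++ A ∷ B ∷ z) ⇔ SerOrdered (u ++ (A ∪ B) ∷ z)
  SerOrdered-merge [] A B z A→B = mk⇔
    (λ (A→Bz , B→z , ordered) → from SerProd-∪ˡ (proj₂ (to SerProd-∪ʳ A→Bz) , B→z) , ordered)
    (λ (AB→z , ordered) → from SerProd-∪ʳ (A→B , proj₁ (to SerProd-∪ˡ AB→z))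
                         , proj₂ (to SerProd-∪ˡ AB→z) , ordered)
  SerOrdered-merge (D ∷ u) A B z A→B = mk⇔
    (λ (D→x , ordered) → subst (SerProd D) ⋃x≡⋃y D→x , to IH ordered)
    (λ (D→y , ordered) → subst (SerProd D) (sym ⋃x≡⋃y) D→y , from IH ordered)
    where
    ⋃x≡⋃y = ⋃-++-merge u A B z
    IH = SerOrdered-merge u A B z A→B

  SerOrdered-resp-∼ : ∀ {x y} → x ∼ y → SerOrdered x ⇔ SerOrdered y
  SerOrdered-resp-∼ (merge u A B z _ _ A→B) = SerOrdered-merge u A B z A→B

  ⋃-≡Θ-singleton : ∀ {Cs M} → Cs ≡Θ (M ∷ []) → ⋃ Cs ≡ M
  ⋃-≡Θ-singleton {M = M} eq = trans (EqClosure.gfold ≡-isEquivalence ⋃ ⋃-resp-∼ eq) (∪-identityʳ M)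

  SerOrdered-≡Θ-singleton : ∀ {Cs M} → Cs ≡Θ (M ∷ []) → SerOrdered Cs
  SerOrdered-≡Θ-singleton eq =
    from (EqClosure.gfold ⇔-isEquivalence SerOrdered SerOrdered-resp-∼ eq) ((λ _ _ _ → ⊥-elim ∘ ∉⊥) , tt)

  Clique-⋃ : ∀ {Ds} → All Clique Ds → SerOrdered Ds → Clique (⋃ Ds)
  Clique-⋃ []         _              _ _ a∈ = ⊥-elim (∉⊥ a∈)
  Clique-⋃ (cD ∷ cDs) (D→Ds , ordered) = Clique-∪ cD (Clique-⋃ cDs ordered) D→Ds

  ⇄⇒↭ : ∀ {x y} → x ⇄ y → x ↭ y
  ⇄⇒↭ (swap u C D z _) = ++⁺ˡ u (↭-swap C D ↭-refl)

  ≈tr⇒↭ : ∀ {x y} → x ≈tr y → x ↭ y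
  ≈tr⇒↭ = EqClosure.fold ↭-isEquivalence ⇄⇒↭

  ⋃-prefix-⊆ : ∀ (p q : List Step) {Cs} → (p ++ q) ≈tr Cs → ⋃ p ⊆ ⋃ Cs
  ⋃-prefix-⊆ p q pq≈Cs {x} x∈ = subst (x ∈_) (⋃-resp-↭ (≈tr⇒↭ pq≈Cs)) (⋃-++-⊆ p q x∈)

  -- For every step meeting {b, c}: does it contain c?  So `head (hits b c xs) ≡ just true`
  -- says that c occurs in xs, no later than the first occurrence of b.
  hit : Act → Act → Step → List Bool
  hit b c D with b ∈? D | c ∈? D
  ... | _     | yes _ = true ∷ []
  ... | yes _ | no _  = false ∷ []
  ... | no _  | no _  = []

  hits : Act → Act → List Step → List Bool
  hits b c = concatMap (hit b c)

  hit-comm : ∀ {b c C D} → ¬ T (ser b c) → IndProd C D → hit b c C ++ hit b c D ≡ hit b c D ++ hit b c C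
  hit-comm {b} {c} {C} {D} ¬b→c C∥D with b ∈? C | c ∈? C | b ∈? D | c ∈? D
  ... | no _    | no _    | _       | _       = sym (++-identityʳ _)
  ... | _       | _       | no _    | no _    = ++-identityʳ _
  ... | yes b∈C | _       | yes b∈D | _       = contradiction (C∥D b b b∈C b∈D) (ind-irrefl b)
  ... | yes b∈C | _       | _       | yes c∈D = contradiction (proj₁ (to T-∧ (C∥D b c b∈C c∈D))) ¬b→c
  ... | _       | yes c∈C | yes b∈D | _       = contradiction (proj₂ (to T-∧ (C∥D c b c∈C b∈D))) ¬b→c
  ... | _       | yes c∈C | _       | yes c∈D = contradiction (C∥D c c c∈C c∈D) (ind-irrefl c)

  hits-resp-⇄ : ∀ {b c} → ¬ T (ser b c) → ∀ {x y} → x ⇄ y → hits b c x ≡ hits b c y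
  hits-resp-⇄ {b} {c} ¬b→c (swap u C D z C∥D) = concatMap-cong-infix (hit b c) pair u z
    where
    pair : hit b c C ++ hit b c D ++ [] ≡ hit b c D ++ hit b c C ++ []
    pair rewrite ++-identityʳ (hit b c D) | ++-identityʳ (hit b c C) = hit-comm ¬b→c C∥D

  hits-resp-≈tr : ∀ {b c} → ¬ T (ser b c) → ∀ {x y} → x ≈tr y → hits b c x ≡ hits b c y
  hits-resp-≈tr {b} {c} ¬b→c = EqClosure.gfold ≡-isEquivalence (hits b c) (hits-resp-⇄ ¬b→c)

  hits-SerOrdered : ∀ {b c} → ¬ T (ser b c) → ∀ Ds → SerOrdered Ds → c ∈ ⋃ Ds →
                    head (hits b c Ds) ≡ just true
  hits-SerOrdered _ [] _ c∈ = ⊥-elim (∉⊥ c∈)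
  hits-SerOrdered {b} {c} ¬b→c (D ∷ Ds) (D→Ds , ordered) c∈ with b ∈? D | c ∈? D
  ... | _       | yes _ = refl
  ... | yes b∈D | no c∉D = contradiction (D→Ds b c b∈D (∈-∪-∉ˡ c∈ c∉D)) ¬b→c
  ... | no _    | no c∉D = hits-SerOrdered ¬b→c Ds ordered (∈-∪-∉ˡ c∈ c∉D)

  hits-prefix : ∀ {b c} (p q : List Step) → head (hits b c (p ++ q)) ≡ just true → b ∈ ⋃ p → c ∈ ⋃ p
  hits-prefix [] _ _ b∈ = ⊥-elim (∉⊥ b∈)
  hits-prefix {b} {c} (D ∷ p) q c-first b∈ with b ∈? D | c ∈? D
  ... | _     | yes c∈D = p⊆p∪q (⋃ p) c∈D
  ... | yes _ | no _    = case c-first of λ ()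
  ... | no b∉D | no _   = q⊆p∪q D (⋃ p) (hits-prefix p q c-first (∈-∪-∉ˡ b∈ b∉D))

  allowed-⊆-M : ∀ {Π B} → Allowed Π B → ∀ {b} → b ∈ B → InM Π b
  allowed-⊆-M (_ , M⇔ , _ , _ , Cs≡M , p , q , _ , pq≈Cs , refl) {b} b∈ =
    to (M⇔ b) (subst (b ∈_) (⋃-≡Θ-singleton Cs≡M) (⋃-prefix-⊆ p q pq≈Cs b∈))

  -- The indivisible steps of M(Π) are ser-ordered, so a c ∈ M(Π) with ¬ ser b c never follows b
  -- in a linearisation of the trace; hence every prefix containing b contains c.
  allowed-closed : ∀ {Π B b c} → Allowed Π B → b ∈ B → InM Π c → ¬ T (ser b c) → c ∈ B
  allowed-closed {c = c} (_ , M⇔ , Cs , _ , Cs≡M , p , q , _ , pq≈Cs , refl) b∈ c∈M ¬b→c =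
    hits-prefix p q c-first b∈
    where
    c∈Cs : c ∈ ⋃ Cs
    c∈Cs = subst (c ∈_) (sym (⋃-≡Θ-singleton Cs≡M)) (from (M⇔ c) c∈M)
    c-first = trans (cong head (hits-resp-≈tr ¬b→c pq≈Cs))
                    (hits-SerOrdered ¬b→c Cs (SerOrdered-≡Θ-singleton Cs≡M) c∈Cs)

  allowed-isStep : ∀ {Π B} → Allowed Π B → IsStep B
  allowed-isStep (_ , _ , _ , indivisible , Cs≡M , p , q , p≢[] , pq≈Cs , refl) =
      ⋃-nonempty p≢[] (++⁻ˡ p (All-resp-↭ (↭-sym (≈tr⇒↭ pq≈Cs)) (All.map (proj₁ ∘ proj₁) indivisible)))
    , Clique-⊆ (⋃-prefix-⊆ p q pq≈Cs)
               (Clique-⋃ (All.map (proj₂ ∘ proj₁) indivisible) (SerOrdered-≡Θ-singleton Cs≡M))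

  together : Act → Act → Word
  together a b = if wdp a b then act b ∷ act a ∷ [] else if wdp b a then act a ∷ act b ∷ [] else bot ∷ []

  projStep-both : ∀ {a b A} → a ≢ b → a ∈ A → b ∈ A → projStep a b A ≡ together a b
  projStep-both {a} {b} {A} a≢b a∈ b∈ with a ≟ b | a ∈? A | b ∈? A
  ... | yes a≡b | _      | _      = contradiction a≡b a≢b
  ... | no _    | yes _  | yes _  = refl
  ... | no _    | no a∉  | _      = contradiction a∈ a∉
  ... | no _    | yes _  | no b∉  = contradiction b∈ b∉

  projStep-left : ∀ {a b A} → a ∈ A → b ∉ A → projStep a b A ≡ act a ∷ []
  projStep-left {a} {b} {A} a∈ b∉ with a ≟ b | a ∈? A | b ∈? A
  ... | yes refl | _      | _      = contradiction a∈ b∉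
  ... | no _     | yes _  | no _   = refl
  ... | no _     | no a∉  | _      = contradiction a∈ a∉
  ... | no _     | yes _  | yes b∈ = contradiction b∈ b∉

  projStep-right : ∀ {a b A} → a ∉ A → b ∈ A → projStep a b A ≡ act b ∷ []
  projStep-right {a} {b} {A} a∉ b∈ with a ≟ b | a ∈? A | b ∈? A
  ... | yes refl | _      | _      = contradiction b∈ a∉
  ... | no _     | no _   | yes _  = refl
  ... | no _     | yes a∈ | _      = contradiction a∈ a∉
  ... | no _     | no _   | no b∉  = contradiction b∈ b∉

  projStep-none : ∀ {a b A} → a ∉ A → b ∉ A → projStep a b A ≡ []
  projStep-none {a} {b} {A} a∉ b∉ with a ≟ b | a ∈? A | b ∈? A
  ... | _     | yes a∈ | _      = contradiction a∈ a∉
  ... | yes _ | no _   | _      = refl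
  ... | no _  | no _   | no _   = refl
  ... | no _  | no _   | yes b∈ = contradiction b∈ b∉

  projStep-self : ∀ {a A} → a ∈ A → projStep a a A ≡ act a ∷ []
  projStep-self {a} {A} a∈ with a ≟ a | a ∈? A
  ... | yes _  | yes _ = refl
  ... | yes _  | no a∉ = contradiction a∈ a∉
  ... | no a≢a | _     = contradiction refl a≢a

  together-ser : ∀ {a b} → T (ser a b) → ¬ T (ser b a) → together a b ≡ act a ∷ act b ∷ []
  together-ser {a} {b} _ ¬b→a with ser a b | ser b a
  ... | true | false = refl
  ... | true | true  = contradiction tt ¬b→a

  together-ser⁻¹ : ∀ {a b} → T (ser b a) → ¬ T (ser a b) → together a b ≡ act b ∷ act a ∷ []
  together-ser⁻¹ {a} {b} _ ¬a→b with ser a b | ser b a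
  ... | false | true = refl
  ... | true  | true = contradiction tt ¬a→b

  projStep-∪-self : ∀ {a A B} → SerProd A B → projStep a a (A ∪ B) ≡ projStep a a A ++ projStep a a B
  projStep-∪-self {a} {A} {B} A→B = go (a ∈? A) (a ∈? B)
    where
    go : Dec (a ∈ A) → Dec (a ∈ B) → projStep a a (A ∪ B) ≡ projStep a a A ++ projStep a a B
    go (yes a∈A) (yes a∈B) = contradiction (A→B a a a∈A a∈B) (ser-irrefl a)
    go (yes a∈A) (no a∉B)
      rewrite projStep-self (p⊆p∪q B a∈A) | projStep-self a∈A | projStep-none a∉B a∉B = refl
    go (no a∉A) (yes a∈B)
      rewrite projStep-self (q⊆p∪q A B a∈B) | projStep-self a∈B | projStep-none a∉A a∉A = refl
    go (no a∉A) (no a∉B)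
      rewrite projStep-none (∉-∪ a∉A a∉B) (∉-∪ a∉A a∉B) | projStep-none a∉A a∉A | projStep-none a∉B a∉B = refl

  projStep-∪-distinct : ∀ {a b A B} → a ≢ b → ¬ T (ind a b) → SerProd A B →
                        projStep a b (A ∪ B) ≡ projStep a b A ++ projStep a b B
  projStep-∪-distinct {a} {b} {A} {B} a≢b ¬a∥b A→B = go (a ∈? A) (a ∈? B) (b ∈? A) (b ∈? B)
    where
    ∪ˡ = p⊆p∪q B
    ∪ʳ = q⊆p∪q A B
    go : Dec (a ∈ A) → Dec (a ∈ B) → Dec (b ∈ A) → Dec (b ∈ B) →
         projStep a b (A ∪ B) ≡ projStep a b A ++ projStep a b B
    go (yes a∈A) (yes a∈B) _ _ = contradiction (A→B a a a∈A a∈B) (ser-irrefl a)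
    go _ _ (yes b∈A) (yes b∈B) = contradiction (A→B b b b∈A b∈B) (ser-irrefl b)
    go (yes a∈A) (no a∉B) (yes b∈A) (no b∉B)
      rewrite projStep-both a≢b (∪ˡ a∈A) (∪ˡ b∈A) | projStep-both a≢b a∈A b∈A | projStep-none a∉B b∉B
      = sym (++-identityʳ _)
    go (yes a∈A) (no a∉B) (no b∉A) (yes b∈B)
      rewrite projStep-both a≢b (∪ˡ a∈A) (∪ʳ b∈B) | projStep-left a∈A b∉A | projStep-right a∉B b∈B
      = together-ser (A→B a b a∈A b∈B) (¬a∥b ∘ from T-∧ ∘ (A→B a b a∈A b∈B ,_))
    go (yes a∈A) (no a∉B) (no b∉A) (no b∉B)
      rewrite projStep-left (∪ˡ a∈A) (∉-∪ b∉A b∉B) | projStep-left a∈A b∉A | projStep-none a∉B b∉B = refl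
    go (no a∉A) (yes a∈B) (yes b∈A) (no b∉B)
      rewrite projStep-both a≢b (∪ʳ a∈B) (∪ˡ b∈A) | projStep-right a∉A b∈A | projStep-left a∈B b∉B
      = together-ser⁻¹ (A→B b a b∈A a∈B) (¬a∥b ∘ from T-∧ ∘ (_, A→B b a b∈A a∈B))
    go (no a∉A) (yes a∈B) (no b∉A) (yes b∈B)
      rewrite projStep-both a≢b (∪ʳ a∈B) (∪ʳ b∈B) | projStep-none a∉A b∉A | projStep-both a≢b a∈B b∈B = refl
    go (no a∉A) (yes a∈B) (no b∉A) (no b∉B)
      rewrite projStep-left (∪ʳ a∈B) (∉-∪ b∉A b∉B) | projStep-none a∉A b∉A | projStep-left a∈B b∉B = refl
    go (no a∉A) (no a∉B) (yes b∈A) (no b∉B)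
      rewrite projStep-right (∉-∪ a∉A a∉B) (∪ˡ b∈A) | projStep-right a∉A b∈A | projStep-none a∉B b∉B = refl
    go (no a∉A) (no a∉B) (no b∉A) (yes b∈B)
      rewrite projStep-right (∉-∪ a∉A a∉B) (∪ʳ b∈B) | projStep-none a∉A b∉A | projStep-right a∉B b∈B = refl
    go (no a∉A) (no a∉B) (no b∉A) (no b∉B)
      rewrite projStep-none (∉-∪ a∉A a∉B) (∉-∪ b∉A b∉B) | projStep-none a∉A b∉A | projStep-none a∉B b∉B = refl

  projStep-∪ : ∀ {a b A B} → ¬ T (ind a b) → SerProd A B →
               projStep a b (A ∪ B) ≡ projStep a b A ++ projStep a b B
  projStep-∪ {a} {b} ¬a∥b A→B = case a ≟ b of λ where
    (yes refl) → projStep-∪-self {a} A→B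
    (no a≢b)   → projStep-∪-distinct a≢b ¬a∥b A→B

  proj-resp-∼ : ∀ {a b} → ¬ T (ind a b) → ∀ {x y} → x ∼ y → proj a b x ≡ proj a b y
  proj-resp-∼ {a} {b} ¬a∥b (merge u A B z _ _ A→B) = concatMap-cong-infix (projStep a b) merged u z
    where
    merged : projStep a b A ++ projStep a b B ++ [] ≡ projStep a b (A ∪ B) ++ []
    merged rewrite ++-identityʳ (projStep a b B) | ++-identityʳ (projStep a b (A ∪ B)) =
      sym (projStep-∪ ¬a∥b A→B)

  proj-resp-≡Θ : ∀ {a b} → ¬ T (ind a b) → ∀ {x y} → x ≡Θ y → proj a b x ≡ proj a b y
  proj-resp-≡Θ {a} {b} ¬a∥b = EqClosure.gfold ≡-isEquivalence (proj a b) (proj-resp-∼ ¬a∥b)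

  drop-together : ∀ {a b} (s : Word) → T (sim a b) → ¬ T (ind a b) →
                  (if ssm a b then drop 1 (together a b ++ s) else drop 2 (together a b ++ s)) ≡ s
  drop-together {a} {b} s _ ¬a∥b with ser a b | ser b a | sim a b
  ... | true  | true  | _    = contradiction tt ¬a∥b
  ... | true  | false | true = refl
  ... | false | true  | true = refl
  ... | false | false | true = refl

  extr-after : ∀ {Π B a b} (s : Word) → ¬ T (ind a b) → Clique B →
               projStep a b B ++ s ≡ Π a b → s ≡ extr Π B a b
  extr-after {B = B} {a} {b} s ¬a∥b cB eq with a ≟ b | a ∈? B | b ∈? B
  ... | yes _  | yes _  | _      = cong (drop 1) eq
  ... | yes _  | no _   | _      = eq
  ... | no _   | no _   | no _   = eq
  ... | no _   | yes _  | no _   = cong (drop 1) eq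
  ... | no _   | no _   | yes _  = cong (drop 1) eq
  ... | no a≢b | yes a∈ | yes b∈ =
    trans (sym (drop-together s (cB a b a∈ b∈ a≢b) ¬a∥b))
          (cong (λ r → if ssm a b then drop 1 r else drop 2 r) eq)

  cpa? : ∀ Π a → Dec (cpa Π a)
  cpa? Π a = all? λ b →
        (T? (dep a b) →-dec head (Π a b) ≟ᵐ just (act a))
    ×-dec (T? (wdp b a) →-dec head (Π a b) ≟ᵐ just (act a))
    ×-dec (T? (wdp a b) →-dec (head (Π a b) ≟ᵐ just (act a) ⊎-dec take 2 (Π a b) ≟ʷ (act b ∷ act a ∷ [])))
    ×-dec (T? (ssm a b) →-dec (head (Π a b) ≟ᵐ just (act a) ⊎-dec head (Π a b) ≟ᵐ just bot))
    where
    _≟ᵐ_ = Maybe.≡-dec _≟ₛ_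
    _≟ʷ_ = List.≡-dec _≟ₛ_

  InM⇒cpa : ∀ {Π a} → InM Π a → cpa Π a
  InM⇒cpa {Π} {a} a∈M = decidable-stable (cpa? Π a) (a∈M ∘ base)

  -- Pulling an allowed set to the front

  -- Within r = Π(b,c), nothing outside B precedes b.
  Leads : Step → Act → Act → Word → Set
  Leads B b c r = head r ≡ just (act b)
                ⊎ (c ∈ B × T (ser c b) × take 2 r ≡ act c ∷ act b ∷ [])
                ⊎ (c ∈ B × head r ≡ just bot)

  record Leading (w : List Step) (B : Step) : Set where
    field leads : ∀ b c → b ∈ B → ¬ T (ind b c) → Leads B b c (proj b c w)
  open Leading

  wdp-intro : ∀ {a b} → T (ser b a) → ¬ T (ser a b) → T (wdp a b)
  wdp-intro b→a ¬a→b = from T-∧ (b→a , ¬T⇒T-not ¬a→b)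

  ssm-intro : ∀ {a b} → T (sim a b) → ¬ T (ser a b) → ¬ T (ser b a) → T (ssm a b)
  ssm-intro a~b ¬a→b ¬b→a = from T-∧ (a~b , from T-∧ (¬T⇒T-not ¬a→b , ¬T⇒T-not ¬b→a))

  allowed⇒Leading : ∀ {w B} → Allowed (projRep w) B → Leading w B
  leads (allowed⇒Leading {w} {B} allowed) b c b∈ ¬b∥c = leads-bc (T? (ser b c)) (T? (ser c b)) (T? (sim b c))
    where
    b∈M = allowed-⊆-M allowed b∈
    cpa-bc = InM⇒cpa b∈M c

    conditional : cnd (projRep w) b c → ¬ T (ser b c) → c ∈ B
    conditional cnd-bc = allowed-closed allowed b∈ (λ c-imp → b∈M (close c-imp cnd-bc))

    leads-bc : Dec (T (ser b c)) → Dec (T (ser c b)) → Dec (T (sim b c)) → Leads B b c (proj b c w)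
    leads-bc (yes b→c) (yes c→b) _ = contradiction (from T-∧ (b→c , c→b)) ¬b∥c
    leads-bc (yes b→c) (no ¬c→b) _ = inj₁ (proj₁ (proj₂ cpa-bc) (wdp-intro b→c ¬c→b))
    leads-bc (no ¬b→c) (yes c→b) _ with proj₁ (proj₂ (proj₂ cpa-bc)) (wdp-intro c→b ¬b→c)
    ... | inj₁ b-first = inj₁ b-first
    ... | inj₂ cb      = inj₂ (inj₁ (conditional (inj₁ (wdp-intro c→b ¬b→c , cb)) ¬b→c , c→b , cb))
    leads-bc (no ¬b→c) (no ¬c→b) (yes b~c) with proj₂ (proj₂ (proj₂ cpa-bc)) (ssm-intro b~c ¬b→c ¬c→b)
    ... | inj₁ b-first   = inj₁ b-first
    ... | inj₂ bot-first =
      inj₂ (inj₂ (conditional (inj₂ (ssm-intro b~c ¬b→c ¬c→b , bot-first)) ¬b→c , bot-first))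
    leads-bc (no _) (no _) (no ¬b~c) = inj₁ (proj₁ cpa-bc (¬T⇒T-not ¬b~c))

  Leading-[] : ∀ {B} → Leading [] B → Empty B
  Leading-[] lead (b , b∈) with leads lead b b b∈ (ind-irrefl b)
  ... | inj₁ ()
  ... | inj₂ (inj₁ (_ , _ , ()))
  ... | inj₂ (inj₂ (_ , ()))

  Leads-single : ∀ {B b c r} → b ≢ c → Leads B b c (act c ∷ r) → c ∈ B × T (ser c b) × head r ≡ just (act b)
  Leads-single b≢c (inj₁ refl)                                = contradiction refl b≢c
  Leads-single {r = _ ∷ _} _ (inj₂ (inj₁ (c∈ , c→b , refl))) = c∈ , c→b , refl
  Leads-single {r = []}    _ (inj₂ (inj₁ (_ , _ , ())))
  Leads-single _ (inj₂ (inj₂ (_ , ())))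

  together-head : ∀ {b a r} → b ≢ a → head (together b a ++ r) ≡ just (act b) → T (ser b a)
  together-head {b} {a} b≢a b-first with ser b a | ser a b | b-first
  ... | true  | _     | _    = tt
  ... | false | true  | refl = contradiction refl b≢a

  module _ {A B : Step} {w : List Step} (lead : Leading (A ∷ w) B) where

    private
      leads-via : ∀ {b c s} → b ∈ B → ¬ T (ind b c) → projStep b c A ≡ s → Leads B b c (s ++ proj b c w)
      leads-via {b} {c} b∈ ¬b∥c eq = subst (λ s → Leads B b c (s ++ proj b c w)) eq (leads lead b c b∈ ¬b∥c)

    Leading-∷-shared→rest : SerProd (B ∩ A) (A ∩ ∁ B)
    Leading-∷-shared→rest b a b∈ a∈ with x∈p∩q⁻ B A b∈ | ∈-∖ a∈ | T? (ind b a)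
    ... | _ | _ | yes b∥a = proj₁ (to T-∧ b∥a)
    ... | b∈B , b∈A | a∈A , a∉B | no ¬b∥a
      with leads-via b∈B ¬b∥a (projStep-both (∈-∉⇒≢ b∈B a∉B) b∈A a∈A)
    ...   | inj₁ b-first           = together-head (∈-∉⇒≢ b∈B a∉B) b-first
    ...   | inj₂ (inj₁ (a∈B , _)) = contradiction a∈B a∉B
    ...   | inj₂ (inj₂ (a∈B , _)) = contradiction a∈B a∉B

    Leading-∷-shared→pending : SerProd (B ∩ A) (B ∩ ∁ A)
    Leading-∷-shared→pending b₁ b₂ b₁∈ b₂∈ with x∈p∩q⁻ B A b₁∈ | ∈-∖ b₂∈ | T? (ind b₂ b₁)
    ... | _ | _ | yes b₂∥b₁ = proj₂ (to T-∧ b₂∥b₁)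
    ... | _ , b₁∈A | b₂∈B , b₂∉A | no ¬b₂∥b₁ =
      proj₁ (proj₂ (Leads-single (∉-∈⇒≢ b₂∉A b₁∈A) (leads-via b₂∈B ¬b₂∥b₁ (projStep-right b₂∉A b₁∈A))))

    Leading-∷-pending∥rest : ∀ b a → b ∈ B ∩ ∁ A → a ∈ A ∩ ∁ B → T (ind b a)
    Leading-∷-pending∥rest b a b∈ a∈ with ∈-∖ b∈ | ∈-∖ a∈ | T? (ind b a)
    ... | _ | _ | yes b∥a = b∥a
    ... | b∈B , b∉A | a∈A , a∉B | no ¬b∥a =
      contradiction (proj₁ (Leads-single (∉-∈⇒≢ b∉A a∈A) (leads-via b∈B ¬b∥a (projStep-right b∉A a∈A)))) a∉B

    Leading-∷ : Leading w (B ∩ ∁ A)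
    leads Leading-∷ b c b∈ ¬b∥c with ∈-∖ b∈ | c ∈? A
    ... | b∈B , b∉A | yes c∈A =
      inj₁ (proj₂ (proj₂ (Leads-single (∉-∈⇒≢ b∉A c∈A) (leads-via b∈B ¬b∥c (projStep-right b∉A c∈A)))))
    ... | b∈B , b∉A | no c∉A with leads-via b∈B ¬b∥c (projStep-none b∉A c∉A)
    ...   | inj₁ b-first            = inj₁ b-first
    ...   | inj₂ (inj₁ (c∈B , cb)) = inj₂ (inj₁ (x∈p∩q⁺ (c∈B , x∉p⇒x∈∁p c∉A) , cb))
    ...   | inj₂ (inj₂ (c∈B , cb)) = inj₂ (inj₂ (x∈p∩q⁺ (c∈B , x∉p⇒x∈∁p c∉A) , cb))

  -- For w = A ∷ w′: B ∩ A is already in front, A ∖ B commutes with B ∖ A, and B ∖ A is pulled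
  -- out of w′ recursively.
  pull-front : ∀ w → All IsStep w → ∀ {B} → Clique B → Leading w B →
               Σ (List Step) λ v → All IsStep v × (⟦ B ⟧ ++ v) ≡Θ w
  pull-front [] [] {B} _ lead = [] , [] , ≡⇒≡Θ (cong (_++ []) (⟦⟧-empty (Leading-[] lead)))
  pull-front (A ∷ w) ((neA , cA) ∷ w-steps) {B} cB lead
    with pull-front w w-steps (Clique-⊆ (p∩q⊆p B (∁ A)) cB) (Leading-∷ lead)
  ... | v , v-steps , pending-w = ⟦ rest ⟧ ++ v , ++⁺ (⟦⟧-isStep c-rest) v-steps , reorder
    where
    shared pending rest : Step
    shared  = B ∩ A
    pending = B ∩ ∁ A
    rest    = A ∩ ∁ B

    c-shared = Clique-⊆ (p∩q⊆p B A) cB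
    c-pending = Clique-⊆ (p∩q⊆p B (∁ A)) cB
    c-rest = Clique-⊆ (p∩q⊆p A (∁ B)) cA

    pending→rest : SerProd pending rest
    pending→rest b a b∈ a∈ = proj₁ (to T-∧ (Leading-∷-pending∥rest lead b a b∈ a∈))

    rest→pending : SerProd rest pending
    rest→pending a b a∈ b∈ = proj₂ (to T-∧ (Leading-∷-pending∥rest lead b a b∈ a∈))

    open import Relation.Binary.Reasoning.Setoid (EqClosure.setoid _∼_)

    reorder : (⟦ B ⟧ ++ ⟦ rest ⟧ ++ v) ≡Θ (A ∷ w)
    reorder = begin
      ⟦ B ⟧ ++ ⟦ rest ⟧ ++ v
        ≡⟨ cong (λ X → ⟦ X ⟧ ++ ⟦ rest ⟧ ++ v) (∩-∁-split B A) ⟨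
      ⟦ shared ∪ pending ⟧ ++ ⟦ rest ⟧ ++ v
        ≈⟨ ⟦⟧-merge _ c-shared c-pending (Leading-∷-shared→pending lead) ⟨
      ⟦ shared ⟧ ++ ⟦ pending ⟧ ++ ⟦ rest ⟧ ++ v
        ≈⟨ ≡Θ-++ˡ ⟦ shared ⟧ (⟦⟧-merge v c-pending c-rest pending→rest) ⟩
      ⟦ shared ⟧ ++ ⟦ pending ∪ rest ⟧ ++ v
        ≡⟨ cong (λ X → ⟦ shared ⟧ ++ ⟦ X ⟧ ++ v) (∪-comm pending rest) ⟩
      ⟦ shared ⟧ ++ ⟦ rest ∪ pending ⟧ ++ v
        ≈⟨ ≡Θ-++ˡ ⟦ shared ⟧ (⟦⟧-merge v c-rest c-pending rest→pending) ⟨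
      ⟦ shared ⟧ ++ ⟦ rest ⟧ ++ ⟦ pending ⟧ ++ v
        ≈⟨ ⟦⟧-merge _ c-shared c-rest (Leading-∷-shared→rest lead) ⟩
      ⟦ shared ∪ rest ⟧ ++ ⟦ pending ⟧ ++ v
        ≡⟨ cong (λ X → ⟦ X ⟧ ++ ⟦ pending ⟧ ++ v) (trans (cong (_∪ rest) (∩-comm B A)) (∩-∁-split A B)) ⟩
      ⟦ A ⟧ ++ ⟦ pending ⟧ ++ v
        ≡⟨ cong (_++ ⟦ pending ⟧ ++ v) (⟦⟧-nonempty neA) ⟩
      A ∷ ⟦ pending ⟧ ++ v
        ≈⟨ ≡Θ-++ˡ (A ∷ []) pending-w ⟩
      A ∷ w
        ∎

  allowed-pull-front : ∀ {w B} → All IsStep w → Allowed (projRep w) B →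
                       Σ (List Step) λ v → All IsStep v × (B ∷ v) ≡Θ w
  allowed-pull-front {w} {B} w-steps allowed
    with pull-front w w-steps (proj₂ (allowed-isStep allowed)) (allowed⇒Leading allowed)
  ... | v , v-steps , B-v≡w =
    v , v-steps , subst (λ u → (u ++ v) ≡Θ w) (⟦⟧-nonempty (proj₁ (allowed-isStep allowed))) B-v≡w

  projRep-extr : ∀ {B v w} → Clique B → (B ∷ v) ≡Θ w →
                 ∀ a b → ¬ T (ind a b) → projRep v a b ≡ extr (projRep w) B a b
  projRep-extr {v = v} cB B∷v≡w a b ¬a∥b = extr-after (proj a b v) ¬a∥b cB (proj-resp-≡Θ ¬a∥b B∷v≡w)

theorem4p7 : (Θ : Alphabet) → let open Comtrace Θ in
    (w : List Step) → All IsStep w →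
    (B : Step) → Allowed (projRep w) B →
    Σ (List Step) λ v → All IsStep v × IsStep B × ((B ∷ v) ≡Θ w) ×
    (∀ a b → ¬ T (ind a b) → projRep v a b ≡ extr (projRep w) B a b)
theorem4p7 Θ w w-steps B allowed =
  let open Extraction Θ
      (v , v-steps , B∷v≡w) = allowed-pull-front w-steps allowed
  in v , v-steps , allowed-isStep allowed , B∷v≡w , projRep-extr (proj₂ (allowed-isStep allowed)) B∷v≡w
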